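{- Let $\mathcal{A}$ and $\mathcal{B}$ be Weyl arrangements of type $A_3$ (over a field $\mathbb{K}$) and let $m:\mathcal{A}\to\mathbb{Z}_{>0}$, $n:\mathcal{B}\to\mathbb{Z}_{>0}$ be multiplicities such that $(\mathcal{A},m)$ and $(\mathcal{B},n)$ are unbalanced. Suppose there is an order-preserving bijection $\varphi:L(\mathcal{A})\to L(\mathcal{B})$ (with respect to reverse inclusion) such that $n(\varphi(H))=m(H)$ for every $H\in\mathcal{A}$. Then $(\mathcal{A},m)$ is free if and only if $(\mathcal{B},n)$ is free; i.e. the freeness of $(\mathcal{A},m)$ depends only on $L(\mathcal{A})$ together with the values $m(H)$, $H\in\mathcal{A}$.
   Context: A multiarrangement $(\mathcal{A},m)$ is an arrangement of linear hyperplanes in $V=\mathbb{K}^\ell$ with $m:\mathcal{A}\to\mathbb{Z}_{>0}$; $|m|=\sum_H m(H)$. It is unbalanced if some $H_0\in\mathcal{A}$ satisfies $2m(H_0)\ge|m|$. $L(\mathcal{A})$ is the intersection lattice (intersections of subsets of $\mathcal{A}$, ordered by reverse inclusion). $D(\mathcal{A},m)=\{\theta\in\mathrm{Der}_{\mathbb{K}}(S):\theta(\alpha_H)\in\alpha_H^{m(H)}S\ \forall H\in\mathcal{A}\}$, $S$ the polynomial ring of $V$, $\alpha_H$ a defining linear form of $H$; $(\mathcal{A},m)$ is free if $D(\mathcal{A},m)$ is a free $S$-module. The Weyl arrangement of type $A_3$ is the (essential rank-3) braid arrangement with the six hyperplanes $x_i=x_j$, $1\le i<j\le4$. -}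

module Defs where

open import Level using (Level; _⊔_) renaming (suc to lsuc)
open import Data.Nat as ℕ using (ℕ; zero; suc; _≤_)
open import Data.Fin using (Fin; zero; suc)
open import Data.Fin.Subset using (Subset; _∈_; ⁅_⁆)
open import Data.Vec using (Vec; []; _∷_; zipWith; replicate)
import Data.Vec.Properties as VecP
open import Data.List using (List; []; _∷_; _++_; map; concatMap)
open import Data.Product using (_×_; _,_; ∃; ∃-syntax)
open import Data.Bool using (if_then_else_)
open import Relation.Nullary using (¬_; does)
open import Relation.Binary.PropositionalEquality using (_≡_)
open import Algebra.Bundles using (CommutativeRing)

record Field c ℓ : Set (lsuc (c ⊔ ℓ)) where
  field
    commutativeRing : CommutativeRing c ℓ
  open CommutativeRing commutativeRing public
  field
    0≉1     : ¬ (0# ≈ 1#)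
    inverse : ∀ x → ¬ (x ≈ 0#) → ∃[ y ] (x * y ≈ 1#)

module Braid {c ℓ} (F : Field c ℓ) where

  open Field F using (_≈_; _+_; _*_; _-_; 0#; 1#) renaming (Carrier to K)

  -- A monomial is its exponent vector; a polynomial is a finite list of
  -- terms (coefficient, monomial).

  Monomial : Set
  Monomial = Vec ℕ 4

  Poly : Set c
  Poly = List (K × Monomial)

  coeff : Poly → Monomial → K
  coeff []            μ = 0#
  coeff ((a , ν) ∷ p) μ =
    if does (VecP.≡-dec ℕ._≟_ ν μ) then a + coeff p μ else coeff p μ

  infix 4 _≈P_
  _≈P_ : Poly → Poly → Set ℓ
  p ≈P q = ∀ μ → coeff p μ ≈ coeff q μ

  0P : Poly
  0P = []

  constP : K → Poly
  constP a = (a , replicate 4 0) ∷ []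

  unit : Fin 4 → Monomial
  unit zero                   = 1 ∷ 0 ∷ 0 ∷ 0 ∷ []
  unit (suc zero)             = 0 ∷ 1 ∷ 0 ∷ 0 ∷ []
  unit (suc (suc zero))       = 0 ∷ 0 ∷ 1 ∷ 0 ∷ []
  unit (suc (suc (suc zero))) = 0 ∷ 0 ∷ 0 ∷ 1 ∷ []

  var : Fin 4 → Poly
  var i = (1# , unit i) ∷ []

  infixl 6 _+P_
  infixl 7 _*P_
  _+P_ : Poly → Poly → Poly
  _+P_ = _++_

  _*P_ : Poly → Poly → Poly
  p *P q = concatMap (λ { (a , ν) → map (λ { (b , κ) → (a * b , zipWith ℕ._+_ ν κ) }) q }) p

  _^P_ : Poly → ℕ → Poly
  f ^P zero  = constP 1#
  f ^P suc k = f *P (f ^P k)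

  _∈_^_S : Poly → Poly → ℕ → Set (c ⊔ ℓ)
  f ∈ g ^ k S = ∃[ h ] (f ≈P (g ^P k) *P h)

  LinForm : Set c
  LinForm = Fin 4 → K

  eval : LinForm → (Fin 4 → K) → K
  eval α v = go 4 (λ i → α i * v i)
    where
    go : (k : ℕ) → (Fin k → K) → K
    go zero    f = 0#
    go (suc k) f = f zero + go k (λ i → f (suc i))

  -- Der_𝕂(S) is the free S-module on ∂/∂x₀,…,∂/∂x₃; a derivation θ is
  -- given by the 4-tuple (θ(x₀),…,θ(x₃)).  For a linear form α,
  -- θ(α) = Σ α_i θ(x_i).

  Der : Set c
  Der = Fin 4 → Poly

  apply : Der → LinForm → Poly
  apply θ α = go 4 λ i → constP (α i) *P θ i
    where
    go : (k : ℕ) → (Fin k → Poly) → Poly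
    go zero    f = 0P
    go (suc k) f = f zero +P go k (λ i → f (suc i))

  infix 4 _≈D_
  _≈D_ : Der → Der → Set ℓ
  θ ≈D δ = ∀ i → θ i ≈P δ i

  0D : Der
  0D = λ _ → 0P

  comb : {k : ℕ} → (Fin k → Poly) → (Fin k → Der) → Der
  comb {zero}  f θ = 0D
  comb {suc k} f θ j = f zero *P θ zero j +P comb (λ i → f (suc i)) (λ i → θ (suc i)) j

  -- The Weyl arrangement of type A₃: hyperplanes x_i = x_j, i < j,
  -- indexed by Fin 6, with defining forms α_H = x_i - x_j.

  pair : Fin 6 → Fin 4 × Fin 4
  pair zero                               = zero , suc zero
  pair (suc zero)                         = zero , suc (suc zero)
  pair (suc (suc zero))                   = zero , suc (suc (suc zero))
  pair (suc (suc (suc zero)))             = suc zero , suc (suc zero)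
  pair (suc (suc (suc (suc zero))))       = suc zero , suc (suc (suc zero))
  pair (suc (suc (suc (suc (suc zero))))) = suc (suc zero) , suc (suc (suc zero))

  e : Fin 4 → LinForm
  e i j = if does (Data.Fin._≟_ i j) then 1# else 0#

  α : Fin 6 → LinForm
  α H k with pair H
  ... | (i , j) = e i k - e j k

  Multiplicity : (Fin 6 → ℕ) → Set
  Multiplicity m = ∀ H → 1 ≤ m H

  ∣_∣ₘ : (Fin 6 → ℕ) → ℕ
  ∣ m ∣ₘ = go 6 m
    where
    go : (k : ℕ) → (Fin k → ℕ) → ℕ
    go zero    f = 0
    go (suc k) f = f zero ℕ.+ go k (λ i → f (suc i))

  Unbalanced : (Fin 6 → ℕ) → Set
  Unbalanced m = ∃[ H₀ ] (∣ m ∣ₘ ≤ 2 ℕ.* m H₀)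

  InD : (Fin 6 → ℕ) → Der → Set (c ⊔ ℓ)
  InD m θ = ∀ H → apply θ (α H) ∈ toPoly (α H) ^ m H S
    where
    toPoly : LinForm → Poly
    toPoly β = go 4 λ i → constP (β i) *P var i
      where
      go : (k : ℕ) → (Fin k → Poly) → Poly
      go zero    f = 0P
      go (suc k) f = f zero +P go k (λ i → f (suc i))

  IsFree : (Fin 6 → ℕ) → Set (c ⊔ ℓ)
  IsFree m = ∃[ k ] ∃[ θ ] (
      (∀ i → InD m (θ i))
    × (∀ δ → InD m δ → ∃[ f ] (δ ≈D comb {k} f θ))
    × (∀ f → comb {k} f θ ≈D 0D → ∀ i → f i ≈P 0P))

  -- An element is the intersection
  -- ⋂_{H ∈ T} H of a subset T ⊆ A (T = ∅ gives V); a subset T is a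
  -- representative, and two subsets represent the same element iff
  -- their intersections coincide as subsets of V.

  _∈⋂_ : (Fin 4 → K) → Subset 6 → Set ℓ
  v ∈⋂ T = ∀ H → H ∈ T → eval (α H) v ≈ 0#

  infix 4 _≃L_
  _≃L_ : Subset 6 → Subset 6 → Set (c ⊔ ℓ)
  T ≃L T' = ∀ v → (v ∈⋂ T → v ∈⋂ T') × (v ∈⋂ T' → v ∈⋂ T)

  infix 4 _≤L_
  _≤L_ : Subset 6 → Subset 6 → Set (c ⊔ ℓ)
  T ≤L T' = ∀ v → v ∈⋂ T' → v ∈⋂ T

  -- φ : L(A) → L(B) (given on representatives) is a well-defined,
  -- order-preserving bijection.
  record OrderPreservingBijection (φ : Subset 6 → Subset 6) : Set (c ⊔ ℓ) where
    field
      well-defined : ∀ T T' → T ≃L T' → φ T ≃L φ T'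
      injective    : ∀ T T' → φ T ≃L φ T' → T ≃L T'
      surjective   : ∀ T' → ∃[ T ] (φ T ≃L T')
      monotone     : ∀ T T' → T ≤L T' → φ T ≤L φ T'

  PreservesMult : (Subset 6 → Subset 6) → (Fin 6 → ℕ) → (Fin 6 → ℕ) → Set (c ⊔ ℓ)
  PreservesMult φ m n = ∀ H → ∃[ H' ] ((φ ⁅ H ⁆ ≃L ⁅ H' ⁆) × (n H' ≡ m H))

module Submission where

-- The hyperplanes xᵢ = xⱼ are the edges of the complete graph K₄ on the coordinates,
-- and H lies in the closure of S ⊆ A iff the ends of the edge H are joined by a walk
-- in S.  (1) Using only monotonicity and injectivity of φ, the map g it induces on
-- hyperplanes is injective and sends triangles (dependent triples) to triangles; by
-- Whitney's theorem for K₄, checked exhaustively, g is induced by a permutation π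
-- of the coordinates, so n ∘ π = m.  (2) Relabelling the variables by π is a ring
-- automorphism of S which, up to the sign of each defining form, carries D(A,m)
-- into D(A,n) and S-bases to S-bases, so freeness transfers in both directions.

open import Defs
open import Data.Nat as ℕ using (ℕ; zero; suc; _∸_; _≤?_)
import Data.Nat.Properties as ℕP
open import Data.Bool as Bool using (Bool; true; false; if_then_else_)
open import Data.Fin using (Fin; zero; suc; _≟_)
open import Data.Fin.Patterns using (0F; 1F; 2F; 3F; 4F; 5F)
open import Data.Fin.Properties using (all?; any?)
open import Data.Fin.Subset using (Subset; _∈_; ⁅_⁆; _∪_; ⊤)
open import Data.Fin.Subset.Properties using (_∈?_; anySubset?; x∈⁅x⁆; x∈⁅y⁆⇒x≡y; x∈p∪q⁻; x∈p∪q⁺; ∈⊤)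
open import Data.Fin.Permutation using (Permutation′; _⟨$⟩ʳ_; _⟨$⟩ˡ_; inverseˡ; inverseʳ; insert; flip)
import Data.Fin.Permutation as Perm
open import Data.Vec using (Vec; []; _∷_; zipWith; replicate; lookup; tabulate)
import Data.Vec.Properties as VecP
import Data.List.Properties as ListP
open import Data.List as List using ([]; _∷_; _++_; map; length)
open import Algebra.Bundles using (Semiring)
import Algebra.Properties.Ring as RingProperties
open import Data.Product using (_×_; _,_; proj₁; proj₂; ∃; ∃-syntax)
open import Data.Sum using (_⊎_; inj₁; inj₂; [_,_]′)
open import Data.Empty using (⊥-elim)
open import Function using (_∘_; mk⇔)
open import Relation.Nullary using (¬_; Dec; yes; no; does)
open import Relation.Nullary.Decidable using (does-⇔; from-yes; _×-dec_; _⊎-dec_; _→-dec_; ¬?)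
open import Relation.Binary.PropositionalEquality as ≡ using (_≡_; _≢_; refl; cong; cong₂)

infixl 6 _⊕_
_⊕_ : ∀ {k} → Vec ℕ k → Vec ℕ k → Vec ℕ k
_⊕_ = zipWith ℕ._+_

quotient? : ∀ {k} (ν μ : Vec ℕ k) → Dec (∃ λ κ → ν ⊕ κ ≡ μ)
quotient? []      []      = yes ([] , refl)
quotient? (x ∷ ν) (y ∷ μ) with x ≤? y | quotient? ν μ
... | yes x≤y | yes (κ , ν⊕κ≡μ) = yes (y ∸ x ∷ κ , cong₂ _∷_ (ℕP.m+[n∸m]≡n x≤y) ν⊕κ≡μ)
... | no x≰y  | _               =
  no λ { (i ∷ κ , eq) → x≰y (≡.subst (x ℕ.≤_) (VecP.∷-injectiveˡ eq) (ℕP.m≤m+n x i)) }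
... | yes _   | no ∄κ           = no λ { (i ∷ κ , eq) → ∄κ (κ , VecP.∷-injectiveʳ eq) }

⊕-cancelˡ : ∀ {k} (ν : Vec ℕ k) {κ κ′} → ν ⊕ κ ≡ ν ⊕ κ′ → κ ≡ κ′
⊕-cancelˡ []      {[]}    {[]}      _  = refl
⊕-cancelˡ (x ∷ ν) {i ∷ κ} {i′ ∷ κ′} eq =
  cong₂ _∷_ (ℕP.+-cancelˡ-≡ x i i′ (VecP.∷-injectiveˡ eq)) (⊕-cancelˡ ν (VecP.∷-injectiveʳ eq))

⊕-comm : ∀ {k} (ν κ : Vec ℕ k) → ν ⊕ κ ≡ κ ⊕ ν
⊕-comm = VecP.zipWith-comm ℕP.+-comm

⊕-identityˡ : ∀ {k} (ν : Vec ℕ k) → replicate k 0 ⊕ ν ≡ ν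
⊕-identityˡ = VecP.zipWith-identityˡ ℕP.+-identityˡ

⊕-tabulate : ∀ {k} (f g : Fin k → ℕ) → tabulate f ⊕ tabulate g ≡ tabulate (λ j → f j ℕ.+ g j)
⊕-tabulate {zero}  f g = refl
⊕-tabulate {suc k} f g = cong (f zero ℕ.+ g zero ∷_) (⊕-tabulate (f ∘ suc) (g ∘ suc))

ends : Fin 6 → Fin 4 × Fin 4
ends 0F = 0F , 1F
ends 1F = 0F , 2F
ends 2F = 0F , 3F
ends 3F = 1F , 2F
ends 4F = 1F , 3F
ends 5F = 2F , 3F

src tgt : Fin 6 → Fin 4
src H = proj₁ (ends H)
tgt H = proj₂ (ends H)

-- The hyperplane x_a = x_b (for a ≢ b; the diagonal value is irrelevant).
edge : Fin 4 → Fin 4 → Fin 6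
edge 0F 1F = 0F
edge 0F 2F = 1F
edge 0F 3F = 2F
edge 1F 2F = 3F
edge 1F 3F = 4F
edge 2F 3F = 5F
edge 1F 0F = 0F
edge 2F 0F = 1F
edge 3F 0F = 2F
edge 2F 1F = 3F
edge 3F 1F = 4F
edge 3F 2F = 5F
edge _  _  = 0F

-- Finite facts about K₄ are established by evaluating a decision procedure:
-- from-yes d has type P whenever the decision d : Dec P evaluates to yes.

src≢tgt : ∀ H → src H ≢ tgt H
src≢tgt = from-yes (all? λ H → ¬? (src H ≟ tgt H))

edge-ends : ∀ H → edge (src H) (tgt H) ≡ H
edge-ends = from-yes (all? λ H → edge (src H) (tgt H) ≟ H)

edge-sym : ∀ a b → edge a b ≡ edge b a
edge-sym = from-yes (all? λ a → all? λ b → edge a b ≟ edge b a)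

ends-edge : ∀ a b → a ≢ b →
  (src (edge a b) ≡ a × tgt (edge a b) ≡ b) ⊎ (src (edge a b) ≡ b × tgt (edge a b) ≡ a)
ends-edge = from-yes (all? λ a → all? λ b → ¬? (a ≟ b) →-dec
  ((src (edge a b) ≟ a ×-dec tgt (edge a b) ≟ b) ⊎-dec (src (edge a b) ≟ b ×-dec tgt (edge a b) ≟ a)))

induced : Permutation′ 4 → Fin 6 → Fin 6
induced π H = edge (π ⟨$⟩ʳ src H) (π ⟨$⟩ʳ tgt H)

induced-inverse : ∀ π H → induced π (induced (flip π) H) ≡ H
induced-inverse π H with ends-edge (π ⟨$⟩ˡ src H) (π ⟨$⟩ˡ tgt H) (src≢tgt H ∘ from-injective)
  where
  from-injective : ∀ {a b} → π ⟨$⟩ˡ a ≡ π ⟨$⟩ˡ b → a ≡ b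
  from-injective eq = ≡.trans (≡.sym (inverseʳ π)) (≡.trans (cong (π ⟨$⟩ʳ_) eq) (inverseʳ π))
... | inj₁ (s≡ , t≡) rewrite s≡ | t≡ | inverseʳ π {src H} | inverseʳ π {tgt H} = edge-ends H
... | inj₂ (s≡ , t≡) rewrite s≡ | t≡ | inverseʳ π {src H} | inverseʳ π {tgt H} =
  ≡.trans (edge-sym (tgt H) (src H)) (edge-ends H)

reindex-inverse : ∀ π {m n : Fin 6 → ℕ} →
  (∀ H → n (induced π H) ≡ m H) → ∀ H → m (induced (flip π) H) ≡ n H
reindex-inverse π {m} {n} n∘π≡m H =
  ≡.trans (≡.sym (n∘π≡m (induced (flip π) H))) (cong n (induced-inverse π H))

Reach : ℕ → Subset 6 → Fin 4 → Fin 4 → Set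
Reach zero    S a b = a ≡ b
Reach (suc k) S a b = Reach k S a b ⊎ ∃[ c ] (edge a c ∈ S × Reach k S c b)

reach? : ∀ k S a b → Dec (Reach k S a b)
reach? zero    S a b = a ≟ b
reach? (suc k) S a b = reach? k S a b ⊎-dec any? (λ c → edge a c ∈? S ×-dec reach? k S c b)

-- H lies in the closure of S (graphic matroid of K₄); walks of length 3 suffice.
Spans : Subset 6 → Fin 6 → Set
Spans S H = Reach 3 S (src H) (tgt H)

spans? : ∀ S H → Dec (Spans S H)
spans? S H = reach? 3 S (src H) (tgt H)

Connected : Subset 6 → Set
Connected S = ∀ a b → Reach 3 S a b

dependent-or-connected : ∀ x y z → x ≢ y → x ≢ z → y ≢ z →
  Spans (⁅ x ⁆ ∪ ⁅ y ⁆) z ⊎ Connected (⁅ x ⁆ ∪ ⁅ y ⁆ ∪ ⁅ z ⁆)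
dependent-or-connected = from-yes (all? λ x → all? λ y → all? λ z →
  ¬? (x ≟ y) →-dec ¬? (x ≟ z) →-dec ¬? (y ≟ z) →-dec
  (spans? (⁅ x ⁆ ∪ ⁅ y ⁆) z ⊎-dec all? λ a → all? λ b → reach? 3 (⁅ x ⁆ ∪ ⁅ y ⁆ ∪ ⁅ z ⁆) a b))

-- For edges x, y sharing one endpoint, the edge completing them to a triangle;
-- otherwise x itself.
third : Fin 6 → Fin 6 → Fin 6
third x y = complete (src x) (tgt x) (src y) (tgt y)
  where
  _==_ : Fin 4 → Fin 4 → Bool
  a == b = does (a ≟ b)
  complete : Fin 4 → Fin 4 → Fin 4 → Fin 4 → Fin 6
  complete a b c d =
    if a == c then edge b d else if a == d then edge b c else
    if b == c then edge a d else if b == d then edge a c else x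

third-unique : ∀ x y z → z ≢ x → z ≢ y → Spans (⁅ x ⁆ ∪ ⁅ y ⁆) z → z ≡ third x y
third-unique = from-yes (all? λ x → all? λ y → all? λ z →
  ¬? (z ≟ x) →-dec ¬? (z ≟ y) →-dec spans? (⁅ x ⁆ ∪ ⁅ y ⁆) z →-dec z ≟ third x y)

-- A map of hyperplanes is determined by the images x, y, z of the star of edges
-- at vertex 0 (hyperplanes 0, 1, 2), since 3, 4, 5 complete pairs of them to triangles.
star : Fin 6 → Fin 6 → Fin 6 → Fin 6 → Fin 6
star x y z 0F = x
star x y z 1F = y
star x y z 2F = z
star x y z 3F = third x y
star x y z 4F = third x z
star x y z 5F = third y z

star-triangles : Spans (⁅ 0F ⁆ ∪ ⁅ 1F ⁆) 3F × Spans (⁅ 0F ⁆ ∪ ⁅ 2F ⁆) 4F × Spans (⁅ 1F ⁆ ∪ ⁅ 2F ⁆) 5F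
star-triangles = from-yes
  (spans? (⁅ 0F ⁆ ∪ ⁅ 1F ⁆) 3F ×-dec spans? (⁅ 0F ⁆ ∪ ⁅ 2F ⁆) 4F ×-dec spans? (⁅ 1F ⁆ ∪ ⁅ 2F ⁆) 5F)

perm : Fin 4 → Fin 3 → Fin 2 → Permutation′ 4
perm a b c = insert 0F a (insert 0F b (insert 0F c Perm.id))

-- The check is opaque so that the
-- type checker never re-runs the search when the witness is used.
opaque
  whitney-search : ∀ x y z → (∀ i j → star x y z i ≡ star x y z j → i ≡ j) →
    ∃ λ a → ∃ λ b → ∃ λ c → ∀ H → induced (perm a b c) H ≡ star x y z H
  whitney-search = from-yes (all? λ x → all? λ y → all? λ z →
    (all? λ i → all? λ j → star x y z i ≟ star x y z j →-dec i ≟ j) →-dec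
    (any? λ a → any? λ b → any? λ c → all? λ H → induced (perm a b c) H ≟ star x y z H))

whitney : ∀ x y z → (∀ i j → star x y z i ≡ star x y z j → i ≡ j) →
  ∃[ π ] (∀ H → induced π H ≡ star x y z H)
whitney x y z star-injective = repackage (whitney-search x y z star-injective)
  where
  repackage : (∃ λ a → ∃ λ b → ∃ λ c → ∀ H → induced (perm a b c) H ≡ star x y z H) →
    ∃[ π ] (∀ H → induced π H ≡ star x y z H)
  repackage (a , b , c , induced≗star) = perm a b c , induced≗star

-- A 0/1 point b ⊆ {0,…,3} lies on every hyperplane of S (b does not cut an edge of S).
Agrees : Subset 4 → Subset 6 → Set
Agrees b S = ∀ H → H ∈ S → lookup b (src H) ≡ lookup b (tgt H)

agrees? : ∀ b S → Dec (Agrees b S)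
agrees? b S = all? λ H → H ∈? S →-dec lookup b (src H) Bool.≟ lookup b (tgt H)

Separated : Subset 6 → Subset 6 → Set
Separated S T = ∃[ b ] (Agrees b S × ¬ Agrees b T)

separated? : ∀ S T → Dec (Separated S T)
separated? S T = anySubset? λ b → agrees? b S ×-dec ¬? (agrees? b T)

hyperplanes-separated : ∀ H H′ → H ≢ H′ → Separated ⁅ H ⁆ ⁅ H′ ⁆
hyperplanes-separated = from-yes (all? λ H → all? λ H′ → ¬? (H ≟ H′) →-dec separated? ⁅ H ⁆ ⁅ H′ ⁆)

pairs-separated : ∀ H H′ → Separated (⁅ H ⁆ ∪ ⁅ H′ ⁆) ⊤
pairs-separated = from-yes (all? λ H → all? λ H′ → separated? (⁅ H ⁆ ∪ ⁅ H′ ⁆) ⊤)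

-- The basic tool is that the coefficient of x^μ in p·q is the double
-- sum over pairs of terms whose monomials multiply to x^μ.

module Polynomials {c ℓ} (F : Field c ℓ) where

  open Braid F
  open Field F hiding (zero) renaming (Carrier to K; refl to ≈-refl; sym to ≈-sym; trans to ≈-trans)
  open import Algebra.Properties.Semiring.Sum semiring
    using (sum-syntax; sum-cong-≋; ∑-comm; sum-replicate-zero; *-distribˡ-sum)
  open import Algebra.Properties.CommutativeSemigroup *-commutativeSemigroup using (x∙yz≈y∙xz)
  open import Algebra.Definitions.RawSemiring (Semiring.rawSemiring semiring) using (_^_)
  open import Relation.Binary.Reasoning.Setoid setoid

  Term : Set c
  Term = K × Monomial

  infix 4 _≟ᵐ_
  _≟ᵐ_ : (ν μ : Monomial) → Dec (ν ≡ μ)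
  _≟ᵐ_ = VecP.≡-dec ℕ._≟_

  zeros : Monomial
  zeros = replicate 4 0

  _·_ : Term → Term → Term
  x · y = proj₁ x * proj₁ y , proj₂ x ⊕ proj₂ y

  select : Term → Monomial → K
  select x μ = if does (proj₂ x ≟ᵐ μ) then proj₁ x else 0#

  coeff-∷ : ∀ x p μ → coeff (x ∷ p) μ ≈ select x μ + coeff p μ
  coeff-∷ x p μ with does (proj₂ x ≟ᵐ μ)
  ... | true  = ≈-refl
  ... | false = ≈-sym (+-identityˡ _)

  coeff-++ : ∀ p q μ → coeff (p ++ q) μ ≈ coeff p μ + coeff q μ
  coeff-++ []      q μ = ≈-sym (+-identityˡ _)
  coeff-++ (x ∷ p) q μ = begin
    coeff (x ∷ p ++ q) μ                ≈⟨ coeff-∷ x (p ++ q) μ ⟩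
    select x μ + coeff (p ++ q) μ       ≈⟨ +-congˡ (coeff-++ p q μ) ⟩
    select x μ + (coeff p μ + coeff q μ) ≈⟨ +-assoc _ _ _ ⟨
    (select x μ + coeff p μ) + coeff q μ ≈⟨ +-congʳ (coeff-∷ x p μ) ⟨
    coeff (x ∷ p) μ + coeff q μ          ∎

  coeff-map : ∀ (f : Term → Term) q μ →
    coeff (map f q) μ ≈ ∑[ j < length q ] select (f (List.lookup q j)) μ
  coeff-map f []      μ = ≈-refl
  coeff-map f (y ∷ q) μ = ≈-trans (coeff-∷ (f y) (map f q) μ) (+-congˡ (coeff-map f q μ))

  coeff-as-sum : ∀ q μ → coeff q μ ≈ ∑[ j < length q ] select (List.lookup q j) μ
  coeff-as-sum []      μ = ≈-refl
  coeff-as-sum (y ∷ q) μ = ≈-trans (coeff-∷ y q μ) (+-congˡ (coeff-as-sum q μ))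

  coeff-*P : ∀ p q μ →
    coeff (p *P q) μ ≈ ∑[ i < length p ] ∑[ j < length q ] select (List.lookup p i · List.lookup q j) μ
  coeff-*P []      q μ = ≈-refl
  coeff-*P (x ∷ p) q μ =
    ≈-trans (coeff-++ (map (x ·_) q) (p *P q) μ) (+-cong (coeff-map (x ·_) q μ) (coeff-*P p q μ))

  -- Multiplication is commutative: swap the double sum.
  select-·-comm : ∀ x y μ → select (x · y) μ ≈ select (y · x) μ
  select-·-comm x y μ rewrite ⊕-comm (proj₂ x) (proj₂ y) with does (proj₂ y ⊕ proj₂ x ≟ᵐ μ)
  ... | true  = *-comm _ _
  ... | false = ≈-refl

  *P-comm : ∀ p q → p *P q ≈P q *P p
  *P-comm p q μ = begin
    coeff (p *P q) μ                                      ≈⟨ coeff-*P p q μ ⟩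
    ∑[ i < length p ] ∑[ j < length q ] select (p₍ i ₎ · q₍ j ₎) μ
      ≈⟨ ∑-comm (λ i j → select (p₍ i ₎ · q₍ j ₎) μ) ⟩
    ∑[ j < length q ] ∑[ i < length p ] select (p₍ i ₎ · q₍ j ₎) μ
      ≈⟨ sum-cong-≋ (λ j → sum-cong-≋ (λ i → select-·-comm (p₍ i ₎) (q₍ j ₎) μ)) ⟩
    ∑[ j < length q ] ∑[ i < length p ] select (q₍ j ₎ · p₍ i ₎) μ ≈⟨ coeff-*P q p μ ⟨
    coeff (q *P p) μ                                      ∎
    where
    p₍_₎ : Fin (length p) → Term
    p₍ i ₎ = List.lookup p i
    q₍_₎ : Fin (length q) → Term
    q₍ j ₎ = List.lookup q j

  quotCoeff : Poly → Monomial → Monomial → K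
  quotCoeff q ν μ with quotient? ν μ
  ... | yes (κ , _) = coeff q κ
  ... | no _        = 0#

  ∑-select-shift : ∀ a ν q μ →
    ∑[ j < length q ] select ((a , ν) · List.lookup q j) μ ≈ a * quotCoeff q ν μ
  ∑-select-shift a ν q μ with quotient? ν μ
  ... | yes (κ₀ , ν⊕κ₀≡μ) = begin
    ∑[ j < length q ] select ((a , ν) · q₍ j ₎) μ ≈⟨ sum-cong-≋ (λ j → shifted q₍ j ₎) ⟩
    ∑[ j < length q ] (a * select q₍ j ₎ κ₀)      ≈⟨ *-distribˡ-sum a (λ j → select q₍ j ₎ κ₀) ⟨
    a * ∑[ j < length q ] select q₍ j ₎ κ₀        ≈⟨ *-congˡ (coeff-as-sum q κ₀) ⟨
    a * coeff q κ₀                               ∎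
    where
    q₍_₎ : Fin (length q) → Term
    q₍ j ₎ = List.lookup q j
    shifted : ∀ y → select ((a , ν) · y) μ ≈ a * select y κ₀
    shifted (b , κ) with ν ⊕ κ ≟ᵐ μ | κ ≟ᵐ κ₀
    ... | yes _     | yes _    = ≈-refl
    ... | no _      | no _     = ≈-sym (zeroʳ a)
    ... | yes ν⊕κ≡μ | no κ≢κ₀  = ⊥-elim (κ≢κ₀ (⊕-cancelˡ ν (≡.trans ν⊕κ≡μ (≡.sym ν⊕κ₀≡μ))))
    ... | no ν⊕κ≢μ  | yes refl = ⊥-elim (ν⊕κ≢μ ν⊕κ₀≡μ)
  ... | no ∄κ = begin
    ∑[ j < length q ] select ((a , ν) · List.lookup q j) μ ≈⟨ sum-cong-≋ (λ j → vanishes (List.lookup q j)) ⟩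
    ∑[ j < length q ] 0#                                 ≈⟨ sum-replicate-zero (length q) ⟩
    0#                                                   ≈⟨ zeroʳ a ⟨
    a * 0#                                               ∎
    where
    vanishes : ∀ y → select ((a , ν) · y) μ ≈ 0#
    vanishes (b , κ) with ν ⊕ κ ≟ᵐ μ
    ... | yes ν⊕κ≡μ = ⊥-elim (∄κ (κ , ν⊕κ≡μ))
    ... | no _      = ≈-refl

  coeff-*P-quot : ∀ p q μ →
    coeff (p *P q) μ ≈ ∑[ i < length p ] (proj₁ (List.lookup p i) * quotCoeff q (proj₂ (List.lookup p i)) μ)
  coeff-*P-quot p q μ = ≈-trans (coeff-*P p q μ)
    (sum-cong-≋ (λ i → ∑-select-shift (proj₁ (List.lookup p i)) (proj₂ (List.lookup p i)) q μ))

  quotCoeff-cong : ∀ {q q′} → q ≈P q′ → ∀ ν μ → quotCoeff q ν μ ≈ quotCoeff q′ ν μ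
  quotCoeff-cong q≈q′ ν μ with quotient? ν μ
  ... | yes (κ , _) = q≈q′ κ
  ... | no _        = ≈-refl

  *P-congˡ : ∀ p {q q′} → q ≈P q′ → p *P q ≈P p *P q′
  *P-congˡ p {q} {q′} q≈q′ μ = begin
    coeff (p *P q) μ  ≈⟨ coeff-*P-quot p q μ ⟩
    ∑[ i < length p ] (proj₁ (List.lookup p i) * quotCoeff q (proj₂ (List.lookup p i)) μ)
      ≈⟨ sum-cong-≋ (λ i → *-congˡ (quotCoeff-cong q≈q′ (proj₂ (List.lookup p i)) μ)) ⟩
    ∑[ i < length p ] (proj₁ (List.lookup p i) * quotCoeff q′ (proj₂ (List.lookup p i)) μ)
      ≈⟨ coeff-*P-quot p q′ μ ⟨
    coeff (p *P q′) μ ∎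

  *P-congʳ : ∀ {p p′} q → p ≈P p′ → p *P q ≈P p′ *P q
  *P-congʳ {p} {p′} q p≈p′ μ = begin
    coeff (p *P q) μ  ≈⟨ *P-comm p q μ ⟩
    coeff (q *P p) μ  ≈⟨ *P-congˡ q {p} {p′} p≈p′ μ ⟩
    coeff (q *P p′) μ ≈⟨ *P-comm q p′ μ ⟩
    coeff (p′ *P q) μ ∎

  *P-cong : ∀ {p p′ q q′} → p ≈P p′ → q ≈P q′ → p *P q ≈P p′ *P q′
  *P-cong {p} {p′} {q} {q′} p≈p′ q≈q′ μ =
    ≈-trans (*P-congʳ {p} {p′} q p≈p′ μ) (*P-congˡ p′ {q} {q′} q≈q′ μ)

  ^P-cong : ∀ {p q} → p ≈P q → ∀ k → p ^P k ≈P q ^P k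
  ^P-cong         p≈q zero    μ = ≈-refl
  ^P-cong {p} {q} p≈q (suc k) = *P-cong {p} {q} {p ^P k} {q ^P k} p≈q (^P-cong p≈q k)

  quotCoeff-zeros : ∀ q μ → quotCoeff q zeros μ ≈ coeff q μ
  quotCoeff-zeros q μ with quotient? zeros μ
  ... | yes (κ , zeros⊕κ≡μ) = reflexive (cong (coeff q) (≡.trans (≡.sym (⊕-identityˡ κ)) zeros⊕κ≡μ))
  ... | no ∄κ               = ⊥-elim (∄κ (μ , ⊕-identityˡ μ))

  coeff-scale : ∀ k p μ → coeff (constP k *P p) μ ≈ k * coeff p μ
  coeff-scale k p μ =
    ≈-trans (coeff-*P-quot (constP k) p μ) (≈-trans (+-identityʳ _) (*-congˡ (quotCoeff-zeros p μ)))

  quotCoeff-scale : ∀ k q ν μ → quotCoeff (constP k *P q) ν μ ≈ k * quotCoeff q ν μ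
  quotCoeff-scale k q ν μ with quotient? ν μ
  ... | yes (κ , _) = coeff-scale k q κ
  ... | no _        = ≈-sym (zeroʳ k)

  *P-scaleʳ : ∀ k p q → p *P (constP k *P q) ≈P constP k *P (p *P q)
  *P-scaleʳ k p q μ = begin
    coeff (p *P (constP k *P q)) μ ≈⟨ coeff-*P-quot p (constP k *P q) μ ⟩
    ∑[ i < length p ] (a i * quotCoeff (constP k *P q) (ν i) μ)
      ≈⟨ sum-cong-≋ (λ i → ≈-trans (*-congˡ (quotCoeff-scale k q (ν i) μ)) (x∙yz≈y∙xz (a i) k _)) ⟩
    ∑[ i < length p ] (k * (a i * quotCoeff q (ν i) μ))
      ≈⟨ *-distribˡ-sum k (λ i → a i * quotCoeff q (ν i) μ) ⟨
    k * ∑[ i < length p ] (a i * quotCoeff q (ν i) μ)   ≈⟨ *-congˡ (coeff-*P-quot p q μ) ⟨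
    k * coeff (p *P q) μ                                ≈⟨ coeff-scale k (p *P q) μ ⟨
    coeff (constP k *P (p *P q)) μ                      ∎
    where
    a : Fin (length p) → K
    a i = proj₁ (List.lookup p i)
    ν : Fin (length p) → Monomial
    ν i = proj₂ (List.lookup p i)

  *P-scaleˡ : ∀ k p q → (constP k *P p) *P q ≈P constP k *P (p *P q)
  *P-scaleˡ k p q μ = begin
    coeff ((constP k *P p) *P q) μ ≈⟨ *P-comm (constP k *P p) q μ ⟩
    coeff (q *P (constP k *P p)) μ ≈⟨ *P-scaleʳ k q p μ ⟩
    coeff (constP k *P (q *P p)) μ ≈⟨ *P-congˡ (constP k) {q *P p} {p *P q} (*P-comm q p) μ ⟩
    coeff (constP k *P (p *P q)) μ ∎

  scale-scale : ∀ s t p → constP s *P (constP t *P p) ≈P constP (s * t) *P p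
  scale-scale s t p μ = begin
    coeff (constP s *P (constP t *P p)) μ ≈⟨ coeff-scale s (constP t *P p) μ ⟩
    s * coeff (constP t *P p) μ           ≈⟨ *-congˡ (coeff-scale t p μ) ⟩
    s * (t * coeff p μ)                   ≈⟨ *-assoc s t _ ⟨
    (s * t) * coeff p μ                   ≈⟨ coeff-scale (s * t) p μ ⟨
    coeff (constP (s * t) *P p) μ         ∎

  ^P-scale : ∀ s p k → (constP s *P p) ^P k ≈P constP (s ^ k) *P (p ^P k)
  ^P-scale s p zero    μ = ≈-sym (≈-trans (coeff-scale 1# (constP 1#) μ) (*-identityˡ _))
  ^P-scale s p (suc k) μ = begin
    coeff (sp *P (sp ^P k)) μ                       ≈⟨ *P-scaleˡ s p (sp ^P k) μ ⟩
    coeff (constP s *P (p *P (sp ^P k))) μ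
      ≈⟨ *P-congˡ (constP s) {p *P (sp ^P k)} {p *P sᵏpᵏ} (*P-congˡ p (^P-scale s p k)) μ ⟩
    coeff (constP s *P (p *P sᵏpᵏ)) μ
      ≈⟨ *P-congˡ (constP s) {p *P sᵏpᵏ} {constP (s ^ k) *P (p *P (p ^P k))} (*P-scaleʳ (s ^ k) p (p ^P k)) μ ⟩
    coeff (constP s *P (constP (s ^ k) *P (p *P (p ^P k)))) μ ≈⟨ scale-scale s (s ^ k) (p *P (p ^P k)) μ ⟩
    coeff (constP (s ^ suc k) *P (p ^P suc k)) μ    ∎
    where
    sp sᵏpᵏ : Poly
    sp   = constP s *P p
    sᵏpᵏ = constP (s ^ k) *P (p ^P k)

  ∈-resp-≈P : ∀ f f′ g k → f ≈P f′ → f′ ∈ g ^ k S → f ∈ g ^ k S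
  ∈-resp-≈P f f′ g k f≈f′ (h , f′≈gᵏh) = h , λ μ → ≈-trans (f≈f′ μ) (f′≈gᵏh μ)

  ∈-base-cong : ∀ f g g′ k → g ≈P g′ → f ∈ g ^ k S → f ∈ g′ ^ k S
  ∈-base-cong f g g′ k g≈g′ (h , f≈gᵏh) =
    h , λ μ → ≈-trans (f≈gᵏh μ) (*P-congʳ {g ^P k} {g′ ^P k} h (^P-cong g≈g′ k) μ)

  ∈-scale : ∀ s f g k → f ∈ g ^ k S → (constP s *P f) ∈ g ^ k S
  ∈-scale s f g k (h , f≈gᵏh) = constP s *P h , λ μ → begin
    coeff (constP s *P f) μ              ≈⟨ coeff-scale s f μ ⟩
    s * coeff f μ                        ≈⟨ *-congˡ (f≈gᵏh μ) ⟩
    s * coeff ((g ^P k) *P h) μ          ≈⟨ coeff-scale s ((g ^P k) *P h) μ ⟨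
    coeff (constP s *P ((g ^P k) *P h)) μ ≈⟨ *P-scaleʳ s (g ^P k) h μ ⟨
    coeff ((g ^P k) *P (constP s *P h)) μ ∎

  ∈-unscale : ∀ s f g k → f ∈ (constP s *P g) ^ k S → f ∈ g ^ k S
  ∈-unscale s f g k (h , f≈[sg]ᵏh) = constP (s ^ k) *P h , λ μ → begin
    coeff f μ                                    ≈⟨ f≈[sg]ᵏh μ ⟩
    coeff (((constP s *P g) ^P k) *P h) μ
      ≈⟨ *P-congʳ {(constP s *P g) ^P k} {constP (s ^ k) *P (g ^P k)} h (^P-scale s g k) μ ⟩
    coeff ((constP (s ^ k) *P (g ^P k)) *P h) μ  ≈⟨ *P-scaleˡ (s ^ k) (g ^P k) h μ ⟩
    coeff (constP (s ^ k) *P ((g ^P k) *P h)) μ  ≈⟨ *P-scaleʳ (s ^ k) (g ^P k) h μ ⟨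
    coeff ((g ^P k) *P (constP (s ^ k) *P h)) μ  ∎

  -- Σ_{i<k} fᵢ, with the same shape as the sums in the definitions of apply and InD.
  sumP : (k : ℕ) → (Fin k → Poly) → Poly
  sumP zero    f = 0P
  sumP (suc k) f = f zero +P sumP k (f ∘ suc)

  coeff-sumP : ∀ k f μ → coeff (sumP k f) μ ≈ ∑[ i < k ] coeff (f i) μ
  coeff-sumP zero    f μ = ≈-refl
  coeff-sumP (suc k) f μ =
    ≈-trans (coeff-++ (f zero) (sumP k (f ∘ suc)) μ) (+-congˡ (coeff-sumP k (f ∘ suc) μ))

  -- A linear form as a polynomial, as in the definition of InD.
  asPoly : LinForm → Poly
  asPoly β = apply var β

  coeff-apply : ∀ θ β μ → coeff (apply θ β) μ ≈ ∑[ i < 4 ] (β i * coeff (θ i) μ)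
  coeff-apply θ β μ = ≈-trans (coeff-sumP 4 (λ i → constP (β i) *P θ i) μ)
                              (sum-cong-≋ (λ i → coeff-scale (β i) (θ i) μ))

module LinearForms {c ℓ} (F : Field c ℓ) where

  open Braid F
  open Field F hiding (zero) renaming (Carrier to K; refl to ≈-refl; sym to ≈-sym; trans to ≈-trans)
  open import Algebra.Properties.Semiring.Sum semiring
    using (sum-syntax; sum-cong-≋; sum-replicate-zero; ∑-distrib-+; *-distribˡ-sum)
  open import Relation.Binary.Reasoning.Setoid setoid
  private module RingP = RingProperties ring
  open RingP using (-‿distribˡ-*)

  α-ends : ∀ H k → α H k ≡ e (src H) k - e (tgt H) k
  α-ends 0F k = refl
  α-ends 1F k = refl
  α-ends 2F k = refl
  α-ends 3F k = refl
  α-ends 4F k = refl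
  α-ends 5F k = refl

  ∑-select : ∀ {k} i (f : Fin k → K) → ∑[ j < k ] ((if does (i ≟ j) then 1# else 0#) * f j) ≈ f i
  ∑-select {suc k} zero f = begin
    1# * f zero + ∑[ j < k ] (0# * f (suc j))
      ≈⟨ +-cong (*-identityˡ (f zero)) (sum-cong-≋ (λ j → zeroˡ (f (suc j)))) ⟩
    f zero + ∑[ j < k ] 0#                    ≈⟨ +-congˡ (sum-replicate-zero k) ⟩
    f zero + 0#                               ≈⟨ +-identityʳ (f zero) ⟩
    f zero                                    ∎
  ∑-select {suc k} (suc i) f =
    ≈-trans (+-cong (zeroˡ (f zero)) (∑-select i (f ∘ suc))) (+-identityˡ (f (suc i)))

  eval-e : ∀ i v → eval (e i) v ≈ v i
  eval-e i v = ∑-select i v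

  eval-sub : ∀ β γ v → eval (λ k → β k - γ k) v ≈ eval β v - eval γ v
  eval-sub β γ v = begin
    ∑[ k < 4 ] ((β k - γ k) * v k)
      ≈⟨ sum-cong-≋ (λ k → ≈-trans (distribʳ (v k) (β k) (- γ k)) (+-congˡ (≈-sym (-‿distribˡ-* (γ k) (v k))))) ⟩
    ∑[ k < 4 ] (β k * v k + - (γ k * v k))
      ≈⟨ ∑-distrib-+ (λ k → β k * v k) (λ k → - (γ k * v k)) ⟩
    eval β v + ∑[ k < 4 ] (- (γ k * v k))
      ≈⟨ +-congˡ (sum-cong-≋ (λ k → ≈-sym (RingP.-1*x≈-x (γ k * v k)))) ⟩
    eval β v + ∑[ k < 4 ] (- 1# * (γ k * v k))
      ≈⟨ +-congˡ (*-distribˡ-sum (- 1#) (λ k → γ k * v k)) ⟨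
    eval β v + - 1# * eval γ v
      ≈⟨ +-congˡ (RingP.-1*x≈-x (eval γ v)) ⟩
    eval β v - eval γ v ∎

  eval-α : ∀ H v → eval (α H) v ≈ v (src H) - v (tgt H)
  eval-α H v = begin
    eval (α H) v                             ≈⟨ sum-cong-≋ (λ k → *-congʳ {v k} (reflexive (α-ends H k))) ⟩
    eval (λ k → e (src H) k - e (tgt H) k) v ≈⟨ eval-sub (e (src H)) (e (tgt H)) v ⟩
    eval (e (src H)) v - eval (e (tgt H)) v  ≈⟨ +-cong (eval-e (src H) v) (-‿cong (eval-e (tgt H) v)) ⟩
    v (src H) - v (tgt H)                    ∎

  on-hyperplane⁺ : ∀ H v → v (src H) ≈ v (tgt H) → eval (α H) v ≈ 0#
  on-hyperplane⁺ H v v≈ = ≈-trans (eval-α H v) (RingP.x≈y⇒x∙y⁻¹≈ε v≈)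

  on-hyperplane⁻ : ∀ H v → eval (α H) v ≈ 0# → v (src H) ≈ v (tgt H)
  on-hyperplane⁻ H v v∈H = RingP.x∙y⁻¹≈ε⇒x≈y _ _ (≈-trans (≈-sym (eval-α H v)) v∈H)

-- Relabelling the variables by a permutation π of the coordinates, xᵢ ↦ x_(π i).
-- It is a ring automorphism of S acting on exponent vectors, and acts on
-- derivations by θ ↦ (j ↦ relabel (θ(x_(π⁻¹ j)))).

module Relabelling {c ℓ} (F : Field c ℓ) (π : Permutation′ 4) where

  open Braid F
  open Field F hiding (zero) renaming (Carrier to K; refl to ≈-refl; sym to ≈-sym; trans to ≈-trans)
  open Polynomials F
  open import Algebra.Properties.Semiring.Sum semiring
    using (sum-syntax; sum-cong-≋; sum-permute; *-distribˡ-sum)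
  open import Relation.Binary.Reasoning.Setoid setoid

  σ τ : Fin 4 → Fin 4
  σ i = π ⟨$⟩ʳ i
  τ j = π ⟨$⟩ˡ j

  does-adjoint : ∀ i j → does (i ≟ τ j) ≡ does (σ i ≟ j)
  does-adjoint i j = does-⇔ (mk⇔ (λ i≡τj → ≡.trans (cong σ i≡τj) (inverseʳ π))
                                 (λ σi≡j → ≡.trans (≡.sym (inverseˡ π)) (cong τ σi≡j)))
                            (i ≟ τ j) (σ i ≟ j)

  reindex : (Fin 4 → Fin 4) → Monomial → Monomial
  reindex r ν = tabulate (λ j → lookup ν (r j))

  reindex-∘ : ∀ r r′ ν → reindex r (reindex r′ ν) ≡ reindex (r′ ∘ r) ν
  reindex-∘ r r′ ν = VecP.tabulate-cong (λ j → VecP.lookup∘tabulate (λ i → lookup ν (r′ i)) (r j))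

  reindex-id : ∀ {r} → (∀ j → r j ≡ j) → ∀ ν → reindex r ν ≡ ν
  reindex-id r≗id ν = ≡.trans (VecP.tabulate-cong (λ j → cong (lookup ν) (r≗id j))) (VecP.tabulate∘lookup ν)

  reindex-⊕ : ∀ r ν κ → reindex r (ν ⊕ κ) ≡ reindex r ν ⊕ reindex r κ
  reindex-⊕ r ν κ = ≡.trans (VecP.tabulate-cong (λ j → VecP.lookup-zipWith ℕ._+_ (r j) ν κ))
                            (≡.sym (⊕-tabulate (λ j → lookup ν (r j)) (λ j → lookup κ (r j))))

  -- The substitution xᵢ ↦ x_(σ i) on exponent vectors, and its inverse.
  ρ ρ⁻¹ : Monomial → Monomial
  ρ   = reindex τ
  ρ⁻¹ = reindex σ

  ρ-ρ⁻¹ : ∀ μ → ρ (ρ⁻¹ μ) ≡ μ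
  ρ-ρ⁻¹ μ = ≡.trans (reindex-∘ τ σ μ) (reindex-id (λ j → inverseʳ π) μ)

  ρ⁻¹-ρ : ∀ ν → ρ⁻¹ (ρ ν) ≡ ν
  ρ⁻¹-ρ ν = ≡.trans (reindex-∘ σ τ ν) (reindex-id (λ i → inverseˡ π) ν)

  ρ-zeros : ρ zeros ≡ zeros
  ρ-zeros = VecP.tabulate-cong (λ j → VecP.lookup-replicate (τ j) 0)

  lookup-unit : ∀ i k → lookup (unit i) k ≡ (if does (i ≟ k) then 1 else 0)
  lookup-unit = from-yes (all? λ i → all? λ k → lookup (unit i) k ℕ.≟ (if does (i ≟ k) then 1 else 0))

  ρ-unit : ∀ i → ρ (unit i) ≡ unit (σ i)
  ρ-unit i = ≡.trans (VecP.tabulate-cong unit-entry) (VecP.tabulate∘lookup (unit (σ i)))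
    where
    unit-entry : ∀ j → lookup (unit i) (τ j) ≡ lookup (unit (σ i)) j
    unit-entry j = ≡.trans (lookup-unit i (τ j))
      (≡.trans (cong (λ b → if b then 1 else 0) (does-adjoint i j)) (≡.sym (lookup-unit (σ i) j)))

  relabel : Poly → Poly
  relabel = map (λ x → proj₁ x , ρ (proj₂ x))

  relabel-*P : ∀ p q → relabel (p *P q) ≡ relabel p *P relabel q
  relabel-*P []      q = refl
  relabel-*P (x ∷ p) q = ≡.trans (ListP.map-++ _ (map (x ·_) q) (p *P q))
                                 (cong₂ _++_ (relabel-term q) (relabel-*P p q))
    where
    relabel-term : ∀ q → relabel (map (x ·_) q) ≡ map ((proj₁ x , ρ (proj₂ x)) ·_) (relabel q)
    relabel-term []      = refl
    relabel-term (y ∷ q) =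
      cong₂ _∷_ (cong (proj₁ x * proj₁ y ,_) (reindex-⊕ τ (proj₂ x) (proj₂ y))) (relabel-term q)

  relabel-const : ∀ a → relabel (constP a) ≡ constP a
  relabel-const a = cong (λ ν → (a , ν) ∷ []) ρ-zeros

  relabel-^P : ∀ p k → relabel (p ^P k) ≡ relabel p ^P k
  relabel-^P p zero    = relabel-const 1#
  relabel-^P p (suc k) = ≡.trans (relabel-*P p (p ^P k)) (cong (relabel p *P_) (relabel-^P p k))

  relabel-var : ∀ i → relabel (var i) ≡ var (σ i)
  relabel-var i = cong (λ ν → (1# , ν) ∷ []) (ρ-unit i)

  coeff-relabel : ∀ p μ → coeff (relabel p) μ ≡ coeff p (ρ⁻¹ μ)
  coeff-relabel []            μ = refl
  coeff-relabel ((a , ν) ∷ p) μ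
    rewrite coeff-relabel p μ
          | does-⇔ (mk⇔ (λ ρν≡μ → ≡.trans (≡.sym (ρ⁻¹-ρ ν)) (cong ρ⁻¹ ρν≡μ))
                        (λ ν≡ρ⁻¹μ → ≡.trans (cong ρ ν≡ρ⁻¹μ) (ρ-ρ⁻¹ μ))) (ρ ν ≟ᵐ μ) (ν ≟ᵐ ρ⁻¹ μ) = refl

  relabel-cong : ∀ p q → p ≈P q → relabel p ≈P relabel q
  relabel-cong p q p≈q μ rewrite coeff-relabel p μ | coeff-relabel q μ = p≈q (ρ⁻¹ μ)

  relabel-∈ : ∀ f g k → f ∈ g ^ k S → relabel f ∈ relabel g ^ k S
  relabel-∈ f g k (h , f≈gᵏh) = relabel h , λ μ → begin
    coeff (relabel f) μ                     ≈⟨ relabel-cong f ((g ^P k) *P h) f≈gᵏh μ ⟩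
    coeff (relabel ((g ^P k) *P h)) μ       ≡⟨ cong (λ p → coeff p μ) (relabel-*P (g ^P k) h) ⟩
    coeff (relabel (g ^P k) *P relabel h) μ ≡⟨ cong (λ p → coeff (p *P relabel h) μ) (relabel-^P g k) ⟩
    coeff ((relabel g ^P k) *P relabel h) μ ∎

  relabelDer : Der → Der
  relabelDer θ j = relabel (θ (τ j))

  relabelDer-comb : ∀ {k} (f : Fin k → Poly) (θ : Fin k → Der) j →
    relabelDer (comb f θ) j ≡ comb (relabel ∘ f) (relabelDer ∘ θ) j
  relabelDer-comb {zero}  f θ j = refl
  relabelDer-comb {suc k} f θ j =
    ≡.trans (ListP.map-++ _ (f zero *P θ zero (τ j)) (comb (f ∘ suc) (θ ∘ suc) (τ j)))
            (cong₂ _++_ (relabel-*P (f zero) (θ zero (τ j))) (relabelDer-comb (f ∘ suc) (θ ∘ suc) j))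

  apply-relabel : ∀ θ δ β γ s → (∀ j → δ j ≈P relabel (θ (τ j))) → (∀ j → γ j ≈ s * β (τ j)) →
    apply δ γ ≈P constP s *P relabel (apply θ β)
  apply-relabel θ δ β γ s δ≈θ^π γ≈sβ μ = begin
    coeff (apply δ γ) μ                               ≈⟨ coeff-apply δ γ μ ⟩
    ∑[ j < 4 ] (γ j * coeff (δ j) μ)
      ≈⟨ sum-cong-≋ (λ j → *-cong (γ≈sβ j) (≈-trans (δ≈θ^π j μ) (reflexive (coeff-relabel (θ (τ j)) μ)))) ⟩
    ∑[ j < 4 ] summand (τ j)                          ≈⟨ sum-permute summand (flip π) ⟨
    ∑[ i < 4 ] summand i
      ≈⟨ sum-cong-≋ (λ i → *-assoc s (β i) (coeff (θ i) (ρ⁻¹ μ))) ⟩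
    ∑[ i < 4 ] (s * (β i * coeff (θ i) (ρ⁻¹ μ)))
      ≈⟨ *-distribˡ-sum s (λ i → β i * coeff (θ i) (ρ⁻¹ μ)) ⟨
    s * ∑[ i < 4 ] (β i * coeff (θ i) (ρ⁻¹ μ))        ≈⟨ *-congˡ (coeff-apply θ β (ρ⁻¹ μ)) ⟨
    s * coeff (apply θ β) (ρ⁻¹ μ)                     ≡⟨ cong (s *_) (coeff-relabel (apply θ β) μ) ⟨
    s * coeff (relabel (apply θ β)) μ                 ≈⟨ coeff-scale s (relabel (apply θ β)) μ ⟨
    coeff (constP s *P relabel (apply θ β)) μ         ∎
    where
    summand : Fin 4 → K
    summand i = (s * β i) * coeff (θ i) (ρ⁻¹ μ)

-- Relabelling D(A,m): the form of the induced hyperplane πH is ± the relabelled form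
-- of H, so divisibility of θ(α_H) by α_H^k transfers to θ^π and πH.

module RelabellingD {c ℓ} (F : Field c ℓ) (π : Permutation′ 4) where

  open Braid F
  open Field F hiding (zero) renaming (refl to ≈-refl; sym to ≈-sym; trans to ≈-trans)
  open Polynomials F
  open LinearForms F
  open Relabelling F π
  open import Relation.Binary.Reasoning.Setoid setoid
  private module RingP = RingProperties ring

  -- σ is injective, so the induced hyperplane of an edge is again an edge.
  σ-injective : ∀ {a b} → σ a ≡ σ b → a ≡ b
  σ-injective σa≡σb = ≡.trans (≡.sym (inverseˡ π)) (≡.trans (cong τ σa≡σb) (inverseˡ π))

  e-relabel : ∀ i j → e (σ i) j ≡ e i (τ j)
  e-relabel i j = cong (λ b → if b then 1# else 0#) (≡.sym (does-adjoint i j))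

  α-induced : ∀ H → ∃[ s ] (s * s ≈ 1# × ∀ j → α (induced π H) j ≈ s * α H (τ j))
  α-induced H with ends-edge (σ (src H)) (σ (tgt H)) (src≢tgt H ∘ σ-injective)
  ... | inj₁ (src≡ , tgt≡) = 1# , *-identityˡ 1# , λ j → begin
    α (induced π H) j                         ≡⟨ α-ends (induced π H) j ⟩
    e (src (induced π H)) j - e (tgt (induced π H)) j ≡⟨ cong₂ (λ a b → e a j - e b j) src≡ tgt≡ ⟩
    e (σ (src H)) j - e (σ (tgt H)) j         ≡⟨ cong₂ _-_ (e-relabel (src H) j) (e-relabel (tgt H) j) ⟩
    e (src H) (τ j) - e (tgt H) (τ j)         ≡⟨ α-ends H (τ j) ⟨
    α H (τ j)                                 ≈⟨ *-identityˡ (α H (τ j)) ⟨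
    1# * α H (τ j)                            ∎
  ... | inj₂ (src≡ , tgt≡) = - 1# , -1²≈1 , λ j → begin
    α (induced π H) j                         ≡⟨ α-ends (induced π H) j ⟩
    e (src (induced π H)) j - e (tgt (induced π H)) j ≡⟨ cong₂ (λ a b → e a j - e b j) src≡ tgt≡ ⟩
    e (σ (tgt H)) j - e (σ (src H)) j         ≡⟨ cong₂ _-_ (e-relabel (tgt H) j) (e-relabel (src H) j) ⟩
    e (tgt H) (τ j) - e (src H) (τ j)
      ≈⟨ RingP.⁻¹-anti-homo‿- (e (src H) (τ j)) (e (tgt H) (τ j)) ⟨
    - (e (src H) (τ j) - e (tgt H) (τ j))     ≡⟨ cong -_ (α-ends H (τ j)) ⟨
    - α H (τ j)                               ≈⟨ RingP.-1*x≈-x (α H (τ j)) ⟨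
    - 1# * α H (τ j)                          ∎
    where
    -1²≈1 : - 1# * - 1# ≈ 1#
    -1²≈1 = ≈-trans (RingP.-1*x≈-x (- 1#)) (RingP.-‿involutive 1#)

  var≈relabel : ∀ j → var j ≈P relabel (var (τ j))
  var≈relabel j μ =
    reflexive (cong (λ p → coeff p μ) (≡.sym (≡.trans (relabel-var (τ j)) (cong var (inverseʳ π)))))

  relabel-asPoly : ∀ H s → s * s ≈ 1# → (∀ j → α (induced π H) j ≈ s * α H (τ j)) →
    relabel (asPoly (α H)) ≈P constP s *P asPoly (α (induced π H))
  relabel-asPoly H s s²≈1 α′≈sα μ = begin
    coeff Q^π μ                             ≈⟨ *-identityˡ (coeff Q^π μ) ⟨
    1# * coeff Q^π μ                        ≈⟨ *-congʳ s²≈1 ⟨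
    (s * s) * coeff Q^π μ                   ≈⟨ *-assoc s s (coeff Q^π μ) ⟩
    s * (s * coeff Q^π μ)                   ≈⟨ *-congˡ (coeff-scale s Q^π μ) ⟨
    s * coeff (constP s *P Q^π) μ
      ≈⟨ *-congˡ (apply-relabel var var (α H) (α (induced π H)) s var≈relabel α′≈sα μ) ⟨
    s * coeff (asPoly (α (induced π H))) μ  ≈⟨ coeff-scale s (asPoly (α (induced π H))) μ ⟨
    coeff (constP s *P asPoly (α (induced π H))) μ ∎
    where
    Q^π : Poly
    Q^π = relabel (asPoly (α H))

  relabel-∈-form : ∀ {θ k} H → apply θ (α H) ∈ asPoly (α H) ^ k S →
    apply (relabelDer θ) (α (induced π H)) ∈ asPoly (α (induced π H)) ^ k S
  relabel-∈-form {θ} {k} H θα∈ with α-induced H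
  ... | s , s²≈1 , α′≈sα =
    ∈-resp-≈P (apply (relabelDer θ) (α (induced π H))) (constP s *P relabel θα) Q′ k θ^π-form
      (∈-scale s (relabel θα) Q′ k (∈-unscale s (relabel θα) Q′ k in-sQ′))
    where
    θα Q Q′ : Poly
    θα = apply θ (α H)
    Q  = asPoly (α H)
    Q′ = asPoly (α (induced π H))
    θ^π-form : apply (relabelDer θ) (α (induced π H)) ≈P constP s *P relabel θα
    θ^π-form = apply-relabel θ (relabelDer θ) (α H) (α (induced π H)) s (λ j μ → ≈-refl) α′≈sα
    in-sQ′ : relabel θα ∈ (constP s *P Q′) ^ k S
    in-sQ′ = ∈-base-cong (relabel θα) (relabel Q) (constP s *P Q′) k (relabel-asPoly H s s²≈1 α′≈sα)
                         (relabel-∈ θα Q k θα∈)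

  relabel-InD : ∀ {m n} → (∀ H → n (induced π H) ≡ m H) → ∀ {θ} → InD m θ → InD n (relabelDer θ)
  relabel-InD {m} {n} n∘π≡m {θ} θ∈D H′ =
    ≡.subst (λ H → apply (relabelDer θ) (α H) ∈ asPoly (α H) ^ n H S) (induced-inverse π H′)
      (≡.subst (λ k → apply (relabelDer θ) (α (induced π H)) ∈ asPoly (α (induced π H)) ^ k S)
               (≡.sym (n∘π≡m H)) (relabel-∈-form {θ} {m H} H (θ∈D H)))
    where
    H : Fin 6
    H = induced (flip π) H′

module RelabellingInverse {c ℓ} (F : Field c ℓ) (π : Permutation′ 4) where

  open Braid F
  private
    module R   = Relabelling F π
    module R⁻¹ = Relabelling F (flip π)

  relabel-inverse : ∀ p → R.relabel (R⁻¹.relabel p) ≡ p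
  relabel-inverse []            = refl
  relabel-inverse ((a , ν) ∷ p) = cong₂ _∷_ (cong (a ,_) (R.ρ-ρ⁻¹ ν)) (relabel-inverse p)

  relabelDer-inverse : ∀ θ j → R.relabelDer (R⁻¹.relabelDer θ) j ≡ θ j
  relabelDer-inverse θ j = ≡.trans (relabel-inverse (θ (R.σ (R.τ j)))) (cong θ (inverseʳ π))

module FreenessTransfer {c ℓ} (F : Field c ℓ) where

  open Braid F
  open Field F using (setoid; 0#)
  open import Relation.Binary.Reasoning.Setoid setoid

  comb-cong : ∀ {k} (f : Fin k → Poly) {θ θ′ : Fin k → Der} →
    (∀ i j → θ i j ≡ θ′ i j) → ∀ j → comb f θ j ≡ comb f θ′ j
  comb-cong {zero}  f θ≡θ′ j = refl
  comb-cong {suc k} f θ≡θ′ j =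
    cong₂ (λ p q → f zero *P p +P q) (θ≡θ′ zero j) (comb-cong (f ∘ suc) (θ≡θ′ ∘ suc) j)

  -- The relabelled basis spans D(A,n) and is independent; both are checked by
  -- relabelling back with π⁻¹.
  transfer : ∀ π {m n} → (∀ H → n (induced π H) ≡ m H) → IsFree m → IsFree n
  transfer π {m} {n} n∘π≡m (k , θ , θ∈D , generates , independent) =
    k , R.relabelDer ∘ θ , (λ i → D.relabel-InD {m} {n} n∘π≡m {θ i} (θ∈D i)) , generates′ , independent′
    where
    module R   = Relabelling F π
    module R⁻¹ = Relabelling F (flip π)
    module D   = RelabellingD F π
    module D⁻¹ = RelabellingD F (flip π)
    open RelabellingInverse F π
    open RelabellingInverse F (flip π) using () renaming (relabelDer-inverse to relabelDer-inverse⁻¹)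

    -- δ ∈ D(A,n) pulls back to δ^(π⁻¹) ∈ D(A,m), expand it in the basis and push forward.
    generates′ : ∀ δ → InD n δ → ∃[ f ] (δ ≈D comb f (R.relabelDer ∘ θ))
    generates′ δ δ∈D = R.relabel ∘ f , λ j μ → begin
      coeff (δ j) μ
        ≡⟨ cong (λ p → coeff p μ) (relabelDer-inverse δ j) ⟨
      coeff (R.relabelDer (R⁻¹.relabelDer δ) j) μ
        ≈⟨ R.relabel-cong (R⁻¹.relabelDer δ (R.τ j)) (comb f θ (R.τ j)) (δ^π⁻¹≈Σfθ (R.τ j)) μ ⟩
      coeff (R.relabelDer (comb f θ) j) μ
        ≡⟨ cong (λ p → coeff p μ) (R.relabelDer-comb f θ j) ⟩
      coeff (comb (R.relabel ∘ f) (R.relabelDer ∘ θ) j) μ ∎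
      where
      expansion : ∃[ f ] (R⁻¹.relabelDer δ ≈D comb f θ)
      expansion = generates (R⁻¹.relabelDer δ)
                            (D⁻¹.relabel-InD {n} {m} (reindex-inverse π {m} {n} n∘π≡m) {δ} δ∈D)
      f : Fin k → Poly
      f = proj₁ expansion
      δ^π⁻¹≈Σfθ : R⁻¹.relabelDer δ ≈D comb f θ
      δ^π⁻¹≈Σfθ = proj₂ expansion

    -- A relation among the θᵢ^π pulls back to a relation among the θᵢ.
    independent′ : ∀ g → comb g (R.relabelDer ∘ θ) ≈D 0D → ∀ i → g i ≈P 0P
    independent′ g Σgθ^π≈0 i μ = begin
      coeff (g i) μ
        ≡⟨ cong (λ p → coeff p μ) (relabel-inverse (g i)) ⟨
      coeff (R.relabel (R⁻¹.relabel (g i))) μ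
        ≈⟨ R.relabel-cong (R⁻¹.relabel (g i)) 0P (independent (R⁻¹.relabel ∘ g) pulled-back i) μ ⟩
      0# ∎
      where
      pulled-back : comb (R⁻¹.relabel ∘ g) θ ≈D 0D
      pulled-back j μ = begin
        coeff (comb (R⁻¹.relabel ∘ g) θ j) μ
          ≡⟨ cong (λ p → coeff p μ) (comb-cong (R⁻¹.relabel ∘ g) (relabelDer-inverse⁻¹ ∘ θ) j) ⟨
        coeff (comb (R⁻¹.relabel ∘ g) (R⁻¹.relabelDer ∘ R.relabelDer ∘ θ) j) μ
          ≡⟨ cong (λ p → coeff p μ) (R⁻¹.relabelDer-comb g (R.relabelDer ∘ θ) j) ⟨
        coeff (R⁻¹.relabelDer (comb g (R.relabelDer ∘ θ)) j) μ
          ≈⟨ R⁻¹.relabel-cong (comb g (R.relabelDer ∘ θ) (R⁻¹.τ j)) 0P (Σgθ^π≈0 (R⁻¹.τ j)) μ ⟩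
        0# ∎

  freeness-invariant : ∀ π {m n} → (∀ H → n (induced π H) ≡ m H) →
    (IsFree m → IsFree n) × (IsFree n → IsFree m)
  freeness-invariant π {m} {n} n∘π≡m =
    transfer π {m} {n} n∘π≡m , transfer (flip π) {n} {m} (reindex-inverse π {m} {n} n∘π≡m)

-- The intersection lattice of A₃ seen through K₄: walks certify inclusions of
-- intersections, and 0/1 points certify non-inclusions.

module IntersectionLattice {c ℓ} (F : Field c ℓ) where

  open Braid F
  open Field F hiding (zero) renaming (Carrier to K; refl to ≈-refl; sym to ≈-sym; trans to ≈-trans)
  open LinearForms F

  ≃L-sym : ∀ {S T} → S ≃L T → T ≃L S
  ≃L-sym S≃T v = proj₂ (S≃T v) , proj₁ (S≃T v)

  ≃L-trans : ∀ {S T U} → S ≃L T → T ≃L U → S ≃L U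
  ≃L-trans S≃T T≃U v = (proj₁ (T≃U v) ∘ proj₁ (S≃T v)) , (proj₂ (S≃T v) ∘ proj₂ (T≃U v))

  edge-sound : ∀ {v S} a b → v ∈⋂ S → edge a b ∈ S → v a ≈ v b
  edge-sound {v} a b v∈⋂S ab∈S with a ≟ b
  ... | yes refl = ≈-refl
  ... | no a≢b with ends-edge a b a≢b | on-hyperplane⁻ (edge a b) v (v∈⋂S (edge a b) ab∈S)
  ...   | inj₁ (src≡a , tgt≡b) | v-agrees rewrite src≡a | tgt≡b = v-agrees
  ...   | inj₂ (src≡b , tgt≡a) | v-agrees rewrite src≡b | tgt≡a = ≈-sym v-agrees

  reach-sound : ∀ {v S} k {a b} → v ∈⋂ S → Reach k S a b → v a ≈ v b
  reach-sound zero    v∈⋂S refl                   = ≈-refl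
  reach-sound (suc k) v∈⋂S (inj₁ walk)            = reach-sound k v∈⋂S walk
  reach-sound {v} {S} (suc k) {a} v∈⋂S (inj₂ (c , ac∈S , walk)) =
    ≈-trans (edge-sound {v} {S} a c v∈⋂S ac∈S) (reach-sound k v∈⋂S walk)

  spans-sound : ∀ {S H} → Spans S H → ⁅ H ⁆ ≤L S
  spans-sound {S} {H} walk v v∈⋂S H′ H′∈⁅H⁆ rewrite x∈⁅y⁆⇒x≡y H H′∈⁅H⁆ =
    on-hyperplane⁺ H v (reach-sound {v} {S} 3 v∈⋂S walk)

  member-sound : ∀ {S H} → H ∈ S → ⁅ H ⁆ ≤L S
  member-sound {S} {H} H∈S v v∈⋂S H′ H′∈⁅H⁆ rewrite x∈⁅y⁆⇒x≡y H H′∈⁅H⁆ = v∈⋂S H H∈S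

  -- If S is connected, ⋂S is the line of constant vectors, which lies in every ⋂T.
  connected-sound : ∀ {S} → Connected S → ∀ T → T ≤L S
  connected-sound {S} connected T v v∈⋂S H _ =
    on-hyperplane⁺ H v (reach-sound {v} {S} 3 v∈⋂S (connected (src H) (tgt H)))

  indicator : Subset 4 → Fin 4 → K
  indicator b i = if lookup b i then 1# else 0#

  indicator-injective : ∀ x y → (if x then 1# else 0#) ≈ (if y then 1# else 0#) → x ≡ y
  indicator-injective true  true  _   = refl
  indicator-injective false false _   = refl
  indicator-injective true  false 1≈0 = ⊥-elim (0≉1 (≈-sym 1≈0))
  indicator-injective false true  0≈1 = ⊥-elim (0≉1 0≈1)

  indicator-∈⋂ : ∀ b S → Agrees b S → indicator b ∈⋂ S
  indicator-∈⋂ b S agrees H H∈S =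
    on-hyperplane⁺ H (indicator b) (reflexive (cong (λ x → if x then 1# else 0#) (agrees H H∈S)))

  ∈⋂-agrees : ∀ b S → indicator b ∈⋂ S → Agrees b S
  ∈⋂-agrees b S b∈⋂S H H∈S = indicator-injective _ _ (on-hyperplane⁻ H (indicator b) (b∈⋂S H H∈S))

  separated⇒≄ : ∀ {S T} → Separated S T → ¬ (S ≃L T)
  separated⇒≄ {S} {T} (b , agrees-S , disagrees-T) S≃T =
    disagrees-T (∈⋂-agrees b T (proj₁ (S≃T (indicator b)) (indicator-∈⋂ b S agrees-S)))

module LatticeIsomorphism {c ℓ} (F : Field c ℓ) (φ : Subset 6 → Subset 6)
  (isBij : Braid.OrderPreservingBijection F φ) (g : Fin 6 → Fin 6)
  (φH≃gH : ∀ H → Braid._≃L_ F (φ ⁅ H ⁆) ⁅ g H ⁆) where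

  open Braid F
  open Field F using (_≈_; 0#)
  open OrderPreservingBijection isBij
  open IntersectionLattice F

  -- g is injective: distinct hyperplanes are distinct elements of L(A), and φ is injective.
  g-injective : ∀ H H′ → g H ≡ g H′ → H ≡ H′
  g-injective H H′ gH≡gH′ with H ≟ H′
  ... | yes H≡H′ = H≡H′
  ... | no H≢H′  = ⊥-elim (separated⇒≄ (hyperplanes-separated H H′ H≢H′) (injective ⁅ H ⁆ ⁅ H′ ⁆ φH≃φH′))
    where
    φH≃φH′ : φ ⁅ H ⁆ ≃L φ ⁅ H′ ⁆
    φH≃φH′ = ≃L-trans (φH≃gH H) (≡.subst (λ K → ⁅ K ⁆ ≃L φ ⁅ H′ ⁆) (≡.sym gH≡gH′) (≃L-sym (φH≃gH H′)))

  on-image : ∀ {S} w → ⁅ w ⁆ ≤L S → ∀ v → v ∈⋂ φ S → eval (α (g w)) v ≈ 0#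
  on-image {S} w w≤S v v∈φS = proj₁ (φH≃gH w v) (monotone ⁅ w ⁆ S w≤S v v∈φS) (g w) (x∈⁅x⁆ (g w))

  -- If z depends on x and y, then g x, g y, g z do not span everything: otherwise
  -- ⋂φ{x,y} would be the line of constants, forcing φ{x,y} = φ(⊤) and so {x,y} = ⊤.
  image-not-connected : ∀ x y z → Spans (⁅ x ⁆ ∪ ⁅ y ⁆) z → ¬ Connected (⁅ g x ⁆ ∪ ⁅ g y ⁆ ∪ ⁅ g z ⁆)
  image-not-connected x y z z-dependent connected =
    separated⇒≄ (pairs-separated x y) (injective S ⊤ φS≃φ⊤)
    where
    S : Subset 6
    S = ⁅ x ⁆ ∪ ⁅ y ⁆
    x∈S : x ∈ S
    x∈S = x∈p∪q⁺ (inj₁ (x∈⁅x⁆ x))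
    y∈S : y ∈ S
    y∈S = x∈p∪q⁺ (inj₂ (x∈⁅x⁆ y))
    on-images : ∀ v → v ∈⋂ φ S → v ∈⋂ (⁅ g x ⁆ ∪ ⁅ g y ⁆ ∪ ⁅ g z ⁆)
    on-images v v∈φS H H∈ with x∈p∪q⁻ ⁅ g x ⁆ (⁅ g y ⁆ ∪ ⁅ g z ⁆) H∈
    ... | inj₁ H∈gx rewrite x∈⁅y⁆⇒x≡y (g x) H∈gx = on-image x (member-sound x∈S) v v∈φS
    ... | inj₂ H∈gyz with x∈p∪q⁻ ⁅ g y ⁆ ⁅ g z ⁆ H∈gyz
    ...   | inj₁ H∈gy rewrite x∈⁅y⁆⇒x≡y (g y) H∈gy = on-image y (member-sound y∈S) v v∈φS
    ...   | inj₂ H∈gz rewrite x∈⁅y⁆⇒x≡y (g z) H∈gz = on-image z (spans-sound z-dependent) v v∈φS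
    φS≃φ⊤ : φ S ≃L φ ⊤
    φS≃φ⊤ v = (λ v∈φS → connected-sound connected (φ ⊤) v (on-images v v∈φS))
            , monotone S ⊤ (λ w w∈⋂⊤ H _ → w∈⋂⊤ H ∈⊤) v

  dependent-image : ∀ x y z → x ≢ y → x ≢ z → y ≢ z →
    Spans (⁅ x ⁆ ∪ ⁅ y ⁆) z → Spans (⁅ g x ⁆ ∪ ⁅ g y ⁆) (g z)
  dependent-image x y z x≢y x≢z y≢z z-dependent =
    [ (λ gz-dependent → gz-dependent) , ⊥-elim ∘ image-not-connected x y z z-dependent ]′
      (dependent-or-connected (g x) (g y) (g z)
        (x≢y ∘ g-injective x y) (x≢z ∘ g-injective x z) (y≢z ∘ g-injective y z))

-- Every order-preserving bijection φ of L(A) respecting multiplicities is induced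
-- on hyperplanes by a permutation π of the coordinates: g (φ on hyperplanes) is
-- injective and preserves triangles, hence is determined by the star g 0, g 1, g 2,
-- and Whitney's theorem provides π.
induced-by-permutation : ∀ {c ℓ} (F : Field c ℓ) {m n : Fin 6 → ℕ} (φ : Subset 6 → Subset 6) →
  Braid.OrderPreservingBijection F φ → Braid.PreservesMult F φ m n →
  ∃[ π ] (∀ H → n (induced π H) ≡ m H)
induced-by-permutation F {m} {n} φ isBij preservesMult = π , n∘π≡m
  where
  g : Fin 6 → Fin 6
  g H = proj₁ (preservesMult H)

  open LatticeIsomorphism F φ isBij g (λ H → proj₁ (proj₂ (preservesMult H)))

  third-image : ∀ x y z → x ≢ y → x ≢ z → y ≢ z → Spans (⁅ x ⁆ ∪ ⁅ y ⁆) z → g z ≡ third (g x) (g y)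
  third-image x y z x≢y x≢z y≢z z-dependent =
    third-unique (g x) (g y) (g z) (λ gz≡gx → x≢z (≡.sym (g-injective z x gz≡gx)))
                                   (λ gz≡gy → y≢z (≡.sym (g-injective z y gz≡gy)))
                                   (dependent-image x y z x≢y x≢z y≢z z-dependent)

  star≗g : ∀ H → star (g 0F) (g 1F) (g 2F) H ≡ g H
  star≗g 0F = refl
  star≗g 1F = refl
  star≗g 2F = refl
  star≗g 3F = ≡.sym (third-image 0F 1F 3F (λ ()) (λ ()) (λ ()) (proj₁ star-triangles))
  star≗g 4F = ≡.sym (third-image 0F 2F 4F (λ ()) (λ ()) (λ ()) (proj₁ (proj₂ star-triangles)))
  star≗g 5F = ≡.sym (third-image 1F 2F 5F (λ ()) (λ ()) (λ ()) (proj₂ (proj₂ star-triangles)))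

  star-injective : ∀ i j → star (g 0F) (g 1F) (g 2F) i ≡ star (g 0F) (g 1F) (g 2F) j → i ≡ j
  star-injective i j eq = g-injective i j (≡.trans (≡.sym (star≗g i)) (≡.trans eq (star≗g j)))

  induced-star : ∃[ π ] (∀ H → induced π H ≡ star (g 0F) (g 1F) (g 2F) H)
  induced-star = whitney (g 0F) (g 1F) (g 2F) star-injective

  π : Permutation′ 4
  π = proj₁ induced-star

  n∘π≡m : ∀ H → n (induced π H) ≡ m H
  n∘π≡m H = ≡.trans (cong n (≡.trans (proj₂ induced-star H) (star≗g H))) (proj₂ (proj₂ (preservesMult H)))

corollary1p4 : ∀ {c ℓ} (F : Field c ℓ) (m n : Fin 6 → ℕ)
    → Braid.Multiplicity F m → Braid.Multiplicity F n
    → Braid.Unbalanced F m → Braid.Unbalanced F n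
    → (φ : Subset 6 → Subset 6)
    → Braid.OrderPreservingBijection F φ
    → Braid.PreservesMult F φ m n
    → (Braid.IsFree F m → Braid.IsFree F n) × (Braid.IsFree F n → Braid.IsFree F m)
corollary1p4 F m n _ _ _ _ φ isBij preservesMult =
  FreenessTransfer.freeness-invariant F π {m} {n} n∘π≡m
  where
  π : Permutation′ 4
  π = proj₁ (induced-by-permutation F {m} {n} φ isBij preservesMult)
  n∘π≡m : ∀ H → n (induced π H) ≡ m H
  n∘π≡m = proj₂ (induced-by-permutation F {m} {n} φ isBij preservesMult)
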